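{- For any digraph $D$ of order $n$ with maximum out-degree $\Delta^+$ and minimum in-degree $\delta^-\ge1$, $\gamma_{\times2}(D)\ge\frac{2n}{\Delta^++1}$. Furthermore, equality holds if and only if $D\in\Theta$.
   Context: Digraphs are finite, without loops or multiple arcs (opposite arcs allowed). A vertex dominates itself and its out-neighbours. A double dominating set is a set $S\subseteq V(D)$ such that every vertex is dominated by at least two vertices of $S$ (each vertex outside $S$ has at least two in-neighbours in $S$, each vertex in $S$ has at least one in-neighbour in $S$); $\gamma_{\times2}(D)$ is its minimum size. A digraph is contrafunctional if every vertex has in-degree exactly one. The family $\Theta$: start with a contrafunctional digraph $D'$ with $V(D')=\{v_1,\dots,v_{n'}\}$. Choose an integer $r\ge\Delta^+(D')$ (maximum out-degree of $D'$) such that $q=(r-1)n'$ is even. Add a set of new vertices $U=\{u_1,\dots,u_{q/2}\}$ and new arcs of the form $(v_i,u_j)$ such that (i) every $u_j$ is incident with precisely two such arcs, and (ii) $\deg^+(v_i)=r$ for all $1\le i\le n'$. Then add some arcs among the vertices of $U$ and some arcs from $U$ to $V(D')$, such that $r$ is the maximum out-degree of the resulting digraph. $\Theta$ is the family of all digraphs obtained this way. -}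

module Defs where

open import Data.Nat using (ℕ; _≤_; _⊔_; _∸_; _*_)
open import Data.Bool using (Bool; true; false; _∧_; not)
open import Data.Fin using (Fin)
open import Data.Fin.Subset using (Subset; ∣_∣; _∩_; _∪_; ⁅_⁆)
open import Data.Vec using (tabulate)
open import Data.List using (foldr; map; allFin)
open import Data.Product using (Σ; _×_)
open import Relation.Binary.PropositionalEquality using (_≡_)

-- A finite digraph on vertex set Fin n: arc u v = true iff (u,v) is an arc.
-- Bool-valued adjacency excludes multiple arcs; opposite arcs are allowed.
record Digraph (n : ℕ) : Set where
  field
    arc      : Fin n → Fin n → Bool
    loopless : ∀ v → arc v v ≡ false
open Digraph public

module _ {n : ℕ} (D : Digraph n) where

  outN : Fin n → Subset n
  outN v = tabulate (λ w → arc D v w)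

  inN : Fin n → Subset n
  inN v = tabulate (λ u → arc D u v)

  outdeg : Fin n → ℕ
  outdeg v = ∣ outN v ∣

  indeg : Fin n → ℕ
  indeg v = ∣ inN v ∣

  -- maximum out-degree Δ⁺(D) (0 for the empty digraph)
  Δ⁺ : ℕ
  Δ⁺ = foldr _⊔_ 0 (map outdeg (allFin n))

  closedInN : Fin n → Subset n
  closedInN v = ⁅ v ⁆ ∪ inN v

  IsDoubleDominating : Subset n → Set
  IsDoubleDominating S = ∀ v → 2 ≤ ∣ S ∩ closedInN v ∣

  IsDoubleDominationNumber : ℕ → Set
  IsDoubleDominationNumber g =
    Σ (Subset n) (λ S → IsDoubleDominating S × ∣ S ∣ ≡ g)
    × (∀ S → IsDoubleDominating S → g ≤ ∣ S ∣)

  -- Membership in the family Θ (up to isomorphism): the vertex set splits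
  -- into V(D') (isV v ≡ true) and U (isV v ≡ false) such that D is obtained
  -- from the contrafunctional digraph D' = D[V(D')] by the construction.
  record InΘ : Set where
    field
      isV : Fin n → Bool
      r   : ℕ
      -- D' = D[V(D')] is contrafunctional (arcs among V(D') are exactly those of D')
      contrafunctional : ∀ v → isV v ≡ true →
        ∣ tabulate (λ u → isV u ∧ arc D u v) ∣ ≡ 1
      r≥Δ⁺D' : ∀ v → isV v ≡ true →
        ∣ tabulate (λ w → isV w ∧ arc D v w) ∣ ≤ r
      -- |U| = q/2 with q = (r-1) n'   (so q is even)
      sizeU : 2 * ∣ tabulate (λ u → not (isV u)) ∣ ≡ (r ∸ 1) * ∣ tabulate isV ∣
      twoArcs : ∀ u → isV u ≡ false →
        ∣ tabulate (λ v → isV v ∧ arc D v u) ∣ ≡ 2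
      outdegV : ∀ v → isV v ≡ true → outdeg v ≡ r
      maxOut : Δ⁺ ≡ r

-- Count the pairs (u, v) with u ∈ S dominating v, once by v and once by u.  Each v is
-- dominated at least twice, and each u dominates itself and at most Δ⁺ out-neighbours, so
-- 2n ≤ Σ_v |S ∩ N⁻[v]| = |S| + Σ_{u ∈ S} deg⁺(u) ≤ |S| (Δ⁺ + 1).  For a set attaining the
-- bound both inequalities are tight: every vertex is dominated exactly twice and every vertex
-- of S has out-degree Δ⁺.  Taking V(D') = S, these are exactly the defining properties of Θ
-- (a vertex of S has one in-neighbour in S, a vertex outside S has two), and conversely V(D')
-- is such a set for every member of Θ.
module Submission where

open import Defs
open import Data.Nat using (ℕ; _≤_; _+_; _*_)
open import Data.Fin using (Fin)
open import Data.Product using (_×_)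
open import Function.Bundles using (_⇔_)
open import Relation.Binary.PropositionalEquality using (_≡_)

open import Data.Nat using (zero; suc; _∸_; _⊔_; z≤n)
open import Data.Nat.Properties
open import Data.Fin using (zero; suc)
open import Data.Fin.Subset using (Subset; ∣_∣; _∩_; _∪_; ⁅_⁆; ∁; ⊥)
open import Data.Fin.Subset.Properties using (x∈⁅y⁆⇒x≡y; ∣∁p∣≡n∸∣p∣)
open import Data.Bool using (Bool; true; false; _∧_; _∨_; not)
open import Data.Bool.Properties using (∧-identityʳ; ∧-zeroʳ)
open import Data.Vec using ([]; _∷_; lookup; tabulate; map)
open import Data.Vec.Properties
  using (lookup∘tabulate; tabulate∘lookup; tabulate-∘; tabulate-cong; lookup-zipWith; lookup⇒[]=; lookup-replicate)
open import Data.Vec.Functional using (Vector)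
open import Data.List using (List; foldr; allFin) renaming (_∷_ to _∷ˡ_)
open import Data.List.Relation.Unary.Any using (here; there)
open import Data.List.Membership.Propositional using (_∈_)
open import Data.List.Membership.Propositional.Properties using (∈-allFin; ∈-map⁺)
open import Data.Product using (_,_)
open import Function.Bundles using (mk⇔)
open import Relation.Binary.PropositionalEquality
  using (refl; sym; trans; cong; cong₂; subst; module ≡-Reasoning)
open import Algebra.Properties.Semiring.Sum +-*-semiring
  using (sum; sum-syntax; sum-replicate-zero; sum-cong-≗; ∑-distrib-+; ∑-comm; *-distribˡ-sum; *-distribʳ-sum)

χ : Bool → ℕ
χ true  = 1
χ false = 0

χ-∧ : ∀ a b → χ (a ∧ b) ≡ χ a * χ b
χ-∧ true  b = sym (+-identityʳ (χ b))
χ-∧ false b = refl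

χ-∧-∨ : ∀ a b c → (b ≡ true → c ≡ false) → χ (a ∧ (b ∨ c)) ≡ χ (a ∧ b) + χ (a ∧ c)
χ-∧-∨ false b     c     _ = refl
χ-∧-∨ true  true  c     disj rewrite disj refl = refl
χ-∧-∨ true  false c     _ = refl

∑-const : ∀ n c → ∑[ i < n ] c ≡ n * c
∑-const zero    c = refl
∑-const (suc n) c = cong (c +_) (∑-const n c)

∑-mono-≤ : ∀ {n} {f g : Vector ℕ n} → (∀ i → f i ≤ g i) → sum f ≤ sum g
∑-mono-≤ {zero}  f≤g = z≤n
∑-mono-≤ {suc n} f≤g = +-mono-≤ (f≤g zero) (∑-mono-≤ (λ i → f≤g (suc i)))

∑-mono-≤-tight : ∀ {n} {f g : Vector ℕ n} → (∀ i → f i ≤ g i) → sum f ≡ sum g → ∀ i → f i ≡ g i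
∑-mono-≤-tight {suc n} {f} {g} f≤g ∑f≡∑g = λ
  { zero    → head≡
  ; (suc i) → ∑-mono-≤-tight (λ j → f≤g (suc j)) (+-cancelˡ-≡ (f zero) _ _ tail-eq) i }
  where
  tail≤ : sum (λ i → f (suc i)) ≤ sum (λ i → g (suc i))
  tail≤ = ∑-mono-≤ (λ i → f≤g (suc i))
  head≡ : f zero ≡ g zero
  head≡ = ≤-antisym (f≤g zero)
    (+-cancelʳ-≤ _ _ _ (≤-trans (≤-reflexive (sym ∑f≡∑g)) (+-monoʳ-≤ (f zero) tail≤)))
  tail-eq : f zero + sum (λ i → f (suc i)) ≡ f zero + sum (λ i → g (suc i))
  tail-eq = trans ∑f≡∑g (cong (_+ sum (λ i → g (suc i))) (sym head≡))

∣p∣≡∑χ : ∀ {n} (p : Subset n) → ∣ p ∣ ≡ ∑[ i < n ] χ (lookup p i)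
∣p∣≡∑χ []          = refl
∣p∣≡∑χ (true  ∷ p) = cong suc (∣p∣≡∑χ p)
∣p∣≡∑χ (false ∷ p) = ∣p∣≡∑χ p

∣tabulate∣≡∑χ : ∀ {n} (f : Fin n → Bool) → ∣ tabulate f ∣ ≡ ∑[ i < n ] χ (f i)
∣tabulate∣≡∑χ f = trans (∣p∣≡∑χ (tabulate f)) (sum-cong-≗ (λ i → cong χ (lookup∘tabulate f i)))

∑χ∧⁅⁆ : ∀ {n} (a : Fin n → Bool) (v : Fin n) → ∑[ u < n ] χ (a u ∧ lookup ⁅ v ⁆ u) ≡ χ (a v)
∑χ∧⁅⁆ {suc n} a zero = trans (cong₂ _+_ (cong χ (∧-identityʳ (a zero))) (begin
  ∑[ u < n ] χ (a (suc u) ∧ lookup ⊥ u)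
    ≡⟨ sum-cong-≗ (λ u → cong (λ b → χ (a (suc u) ∧ b)) (lookup-replicate u false)) ⟩
  ∑[ u < n ] χ (a (suc u) ∧ false)
    ≡⟨ sum-cong-≗ (λ u → cong χ (∧-zeroʳ (a (suc u)))) ⟩
  ∑[ u < n ] 0
    ≡⟨ sum-replicate-zero n ⟩
  0                                     ∎)) (+-identityʳ _)
  where open ≡-Reasoning
∑χ∧⁅⁆ {suc n} a (suc v) = cong₂ _+_ (cong χ (∧-zeroʳ (a zero))) (∑χ∧⁅⁆ (λ u → a (suc u)) v)

x∈xs⇒x≤foldr-⊔ : ∀ {x} (xs : List ℕ) → x ∈ xs → x ≤ foldr _⊔_ 0 xs
x∈xs⇒x≤foldr-⊔ (y ∷ˡ ys) (here refl) = m≤m⊔n y _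
x∈xs⇒x≤foldr-⊔ (y ∷ˡ ys) (there x∈ys) = ≤-trans (x∈xs⇒x≤foldr-⊔ ys x∈ys) (m≤n⊔m y _)

∑χ*c≡∣p∣*c : ∀ {n} (p : Subset n) c → ∑[ i < n ] (χ (lookup p i) * c) ≡ ∣ p ∣ * c
∑χ*c≡∣p∣*c p c = sym (trans (cong (_* c) (∣p∣≡∑χ p)) (*-distribʳ-sum c (λ i → χ (lookup p i))))

∣tabulate-∧∣≤∣tabulate∣ : ∀ {n} (f g : Fin n → Bool) → ∣ tabulate (λ i → f i ∧ g i) ∣ ≤ ∣ tabulate g ∣
∣tabulate-∧∣≤∣tabulate∣ f g = begin
  ∣ tabulate (λ i → f i ∧ g i) ∣ ≡⟨ ∣tabulate∣≡∑χ (λ i → f i ∧ g i) ⟩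
  ∑[ i < _ ] χ (f i ∧ g i)       ≤⟨ ∑-mono-≤ (λ i → χ-∧-≤ (f i) (g i)) ⟩
  ∑[ i < _ ] χ (g i)             ≡⟨ ∣tabulate∣≡∑χ g ⟨
  ∣ tabulate g ∣                 ∎
  where
  open ≤-Reasoning
  χ-∧-≤ : ∀ a b → χ (a ∧ b) ≤ χ b
  χ-∧-≤ true  b = ≤-refl
  χ-∧-≤ false b = z≤n

∣tabulate-not∘lookup∣ : ∀ {n} (p : Subset n) → ∣ tabulate (λ i → not (lookup p i)) ∣ ≡ n ∸ ∣ p ∣
∣tabulate-not∘lookup∣ p = begin
  ∣ tabulate (λ i → not (lookup p i)) ∣ ≡⟨ cong ∣_∣ (tabulate-∘ not (lookup p)) ⟩
  ∣ map not (tabulate (lookup p)) ∣     ≡⟨ cong (λ q → ∣ map not q ∣) (tabulate∘lookup p) ⟩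
  ∣ ∁ p ∣                               ≡⟨ ∣∁p∣≡n∸∣p∣ p ⟩
  _ ∸ ∣ p ∣                             ∎
  where open ≡-Reasoning

2*[n∸g]≡[Δ∸1]*g : ∀ n g Δ → g * (Δ + 1) ≡ 2 * n → 2 * (n ∸ g) ≡ (Δ ∸ 1) * g
2*[n∸g]≡[Δ∸1]*g n g Δ g[Δ+1]≡2n = begin
  2 * (n ∸ g)           ≡⟨ *-distribˡ-∸ 2 n g ⟩
  2 * n ∸ 2 * g         ≡⟨ cong₂ _∸_ (sym g[Δ+1]≡2n) (*-comm 2 g) ⟩
  g * (Δ + 1) ∸ g * 2   ≡⟨ *-distribˡ-∸ g (Δ + 1) 2 ⟨
  g * (Δ + 1 ∸ 2)       ≡⟨ cong (λ m → g * (m ∸ 2)) (+-comm Δ 1) ⟩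
  g * (Δ ∸ 1)           ≡⟨ *-comm g (Δ ∸ 1) ⟩
  (Δ ∸ 1) * g           ∎
  where open ≡-Reasoning

module _ {n : ℕ} (D : Digraph n) where

  indegFrom : Subset n → Fin n → ℕ
  indegFrom S v = ∣ tabulate (λ u → lookup S u ∧ arc D u v) ∣

  IsExactDoubleDominating : Subset n → Set
  IsExactDoubleDominating S = ∀ v → ∣ S ∩ closedInN D v ∣ ≡ 2

  HasMaximumOutdegreeOn : Subset n → Set
  HasMaximumOutdegreeOn S = ∀ u → lookup S u ≡ true → outdeg D u ≡ Δ⁺ D

  outdeg≤Δ⁺ : ∀ u → outdeg D u ≤ Δ⁺ D
  outdeg≤Δ⁺ u = x∈xs⇒x≤foldr-⊔ _ (∈-map⁺ (outdeg D) (∈-allFin u))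

  ⁅⁆-arc-disjoint : ∀ u v → lookup ⁅ v ⁆ u ≡ true → arc D u v ≡ false
  ⁅⁆-arc-disjoint u v u∈⁅v⁆ rewrite x∈⁅y⁆⇒x≡y v (lookup⇒[]= u ⁅ v ⁆ u∈⁅v⁆) = loopless D v

  lookup-∩closedInN : ∀ S v u →
    lookup (S ∩ closedInN D v) u ≡ lookup S u ∧ (lookup ⁅ v ⁆ u ∨ arc D u v)
  lookup-∩closedInN S v u = begin
    lookup (S ∩ closedInN D v) u
      ≡⟨ lookup-zipWith _∧_ u S _ ⟩
    lookup S u ∧ lookup (⁅ v ⁆ ∪ inN D v) u
      ≡⟨ cong (lookup S u ∧_) (lookup-zipWith _∨_ u ⁅ v ⁆ _) ⟩
    lookup S u ∧ (lookup ⁅ v ⁆ u ∨ lookup (inN D v) u)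
      ≡⟨ cong (λ b → lookup S u ∧ (lookup ⁅ v ⁆ u ∨ b)) (lookup∘tabulate _ u) ⟩
    lookup S u ∧ (lookup ⁅ v ⁆ u ∨ arc D u v)
      ∎
    where open ≡-Reasoning

  ∣∩closedInN∣≡χ+indegFrom : ∀ S v → ∣ S ∩ closedInN D v ∣ ≡ χ (lookup S v) + indegFrom S v
  ∣∩closedInN∣≡χ+indegFrom S v = begin
    ∣ S ∩ closedInN D v ∣
      ≡⟨ ∣p∣≡∑χ (S ∩ closedInN D v) ⟩
    ∑[ u < n ] χ (lookup (S ∩ closedInN D v) u)
      ≡⟨ sum-cong-≗ (λ u → trans (cong χ (lookup-∩closedInN S v u)) (χ-∧-∨ _ _ _ (⁅⁆-arc-disjoint u v))) ⟩
    ∑[ u < n ] (χ (lookup S u ∧ lookup ⁅ v ⁆ u) + χ (lookup S u ∧ arc D u v))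
      ≡⟨ ∑-distrib-+ (λ u → χ (lookup S u ∧ lookup ⁅ v ⁆ u)) (λ u → χ (lookup S u ∧ arc D u v)) ⟩
    ∑[ u < n ] χ (lookup S u ∧ lookup ⁅ v ⁆ u) + ∑[ u < n ] χ (lookup S u ∧ arc D u v)
      ≡⟨ cong₂ _+_ (∑χ∧⁅⁆ (lookup S) v) (sym (∣tabulate∣≡∑χ (λ u → lookup S u ∧ arc D u v))) ⟩
    χ (lookup S v) + indegFrom S v
      ∎
    where open ≡-Reasoning

  ∑indegFrom≡∑outdeg : ∀ S → ∑[ v < n ] indegFrom S v ≡ ∑[ u < n ] (χ (lookup S u) * outdeg D u)
  ∑indegFrom≡∑outdeg S = begin
    ∑[ v < n ] indegFrom S v
      ≡⟨ sum-cong-≗ (λ v → ∣tabulate∣≡∑χ (λ u → lookup S u ∧ arc D u v)) ⟩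
    ∑[ v < n ] ∑[ u < n ] χ (lookup S u ∧ arc D u v)
      ≡⟨ ∑-comm (λ v u → χ (lookup S u ∧ arc D u v)) ⟩
    ∑[ u < n ] ∑[ v < n ] χ (lookup S u ∧ arc D u v)
      ≡⟨ sum-cong-≗ out ⟩
    ∑[ u < n ] (χ (lookup S u) * outdeg D u)
      ∎
    where
    open ≡-Reasoning
    out : ∀ u → ∑[ v < n ] χ (lookup S u ∧ arc D u v) ≡ χ (lookup S u) * outdeg D u
    out u = begin
      ∑[ v < n ] χ (lookup S u ∧ arc D u v)
        ≡⟨ sum-cong-≗ (λ v → χ-∧ (lookup S u) (arc D u v)) ⟩
      ∑[ v < n ] (χ (lookup S u) * χ (arc D u v))
        ≡⟨ *-distribˡ-sum (χ (lookup S u)) (λ v → χ (arc D u v)) ⟨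
      χ (lookup S u) * ∑[ v < n ] χ (arc D u v)
        ≡⟨ cong (χ (lookup S u) *_) (∣tabulate∣≡∑χ (arc D u)) ⟨
      χ (lookup S u) * outdeg D u
        ∎

  ∑∣∩closedInN∣≡∣S∣+∑outdeg : ∀ S →
    ∑[ v < n ] ∣ S ∩ closedInN D v ∣ ≡ ∣ S ∣ + ∑[ u < n ] (χ (lookup S u) * outdeg D u)
  ∑∣∩closedInN∣≡∣S∣+∑outdeg S = begin
    ∑[ v < n ] ∣ S ∩ closedInN D v ∣
      ≡⟨ sum-cong-≗ (∣∩closedInN∣≡χ+indegFrom S) ⟩
    ∑[ v < n ] (χ (lookup S v) + indegFrom S v)
      ≡⟨ ∑-distrib-+ (λ v → χ (lookup S v)) (indegFrom S) ⟩
    ∑[ v < n ] χ (lookup S v) + ∑[ v < n ] indegFrom S v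
      ≡⟨ cong₂ _+_ (sym (∣p∣≡∑χ S)) (∑indegFrom≡∑outdeg S) ⟩
    ∣ S ∣ + ∑[ u < n ] (χ (lookup S u) * outdeg D u)
      ∎
    where open ≡-Reasoning

  ∣S∣*[Δ⁺+1]≡∣S∣+∑Δ⁺ : ∀ S → ∣ S ∣ * (Δ⁺ D + 1) ≡ ∣ S ∣ + ∑[ u < n ] (χ (lookup S u) * Δ⁺ D)
  ∣S∣*[Δ⁺+1]≡∣S∣+∑Δ⁺ S = begin
    ∣ S ∣ * (Δ⁺ D + 1)                         ≡⟨ cong (∣ S ∣ *_) (+-comm (Δ⁺ D) 1) ⟩
    ∣ S ∣ * suc (Δ⁺ D)                         ≡⟨ *-suc ∣ S ∣ (Δ⁺ D) ⟩
    ∣ S ∣ + ∣ S ∣ * Δ⁺ D                       ≡⟨ cong (∣ S ∣ +_) (∑χ*c≡∣p∣*c S (Δ⁺ D)) ⟨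
    ∣ S ∣ + ∑[ u < n ] (χ (lookup S u) * Δ⁺ D) ∎
    where open ≡-Reasoning

  χ*outdeg≤χ*Δ⁺ : ∀ S u → χ (lookup S u) * outdeg D u ≤ χ (lookup S u) * Δ⁺ D
  χ*outdeg≤χ*Δ⁺ S u = *-monoʳ-≤ (χ (lookup S u)) (outdeg≤Δ⁺ u)

  ∑outdeg≤∑Δ⁺ : ∀ S → ∑[ u < n ] (χ (lookup S u) * outdeg D u) ≤ ∑[ u < n ] (χ (lookup S u) * Δ⁺ D)
  ∑outdeg≤∑Δ⁺ S = ∑-mono-≤ (χ*outdeg≤χ*Δ⁺ S)

  2n≡∑2 : 2 * n ≡ ∑[ v < n ] 2
  2n≡∑2 = trans (*-comm 2 n) (sym (∑-const n 2))

  double-domination-bound : ∀ S → IsDoubleDominating D S → 2 * n ≤ ∣ S ∣ * (Δ⁺ D + 1)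
  double-domination-bound S S-dd = begin
    2 * n                                             ≡⟨ 2n≡∑2 ⟩
    ∑[ v < n ] 2                                      ≤⟨ ∑-mono-≤ S-dd ⟩
    ∑[ v < n ] ∣ S ∩ closedInN D v ∣                  ≡⟨ ∑∣∩closedInN∣≡∣S∣+∑outdeg S ⟩
    ∣ S ∣ + ∑[ u < n ] (χ (lookup S u) * outdeg D u)  ≤⟨ +-monoʳ-≤ ∣ S ∣ (∑outdeg≤∑Δ⁺ S) ⟩
    ∣ S ∣ + ∑[ u < n ] (χ (lookup S u) * Δ⁺ D)        ≡⟨ ∣S∣*[Δ⁺+1]≡∣S∣+∑Δ⁺ S ⟨
    ∣ S ∣ * (Δ⁺ D + 1)                                ∎
    where open ≤-Reasoning

  double-domination-bound-attained : ∀ S → IsDoubleDominating D S → ∣ S ∣ * (Δ⁺ D + 1) ≡ 2 * n →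
    IsExactDoubleDominating S × HasMaximumOutdegreeOn S
  double-domination-bound-attained S S-dd attained = exact , maximal
    where
    ∑dom ∑out ∑Δ⁺ : ℕ
    ∑dom = ∑[ v < n ] ∣ S ∩ closedInN D v ∣
    ∑out = ∑[ u < n ] (χ (lookup S u) * outdeg D u)
    ∑Δ⁺  = ∑[ u < n ] (χ (lookup S u) * Δ⁺ D)
    ∑2≡∣S∣+∑Δ⁺ : ∑[ v < n ] 2 ≡ ∣ S ∣ + ∑Δ⁺
    ∑2≡∣S∣+∑Δ⁺ = trans (sym 2n≡∑2) (trans (sym attained) (∣S∣*[Δ⁺+1]≡∣S∣+∑Δ⁺ S))
    ∑dom≡∑2 : ∑dom ≡ ∑[ v < n ] 2
    ∑dom≡∑2 = ≤-antisym ∑dom≤∑2 (∑-mono-≤ S-dd)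
      where
      open ≤-Reasoning
      ∑dom≤∑2 : ∑dom ≤ ∑[ v < n ] 2
      ∑dom≤∑2 = begin
        ∑dom          ≡⟨ ∑∣∩closedInN∣≡∣S∣+∑outdeg S ⟩
        ∣ S ∣ + ∑out  ≤⟨ +-monoʳ-≤ ∣ S ∣ (∑outdeg≤∑Δ⁺ S) ⟩
        ∣ S ∣ + ∑Δ⁺   ≡⟨ ∑2≡∣S∣+∑Δ⁺ ⟨
        ∑[ v < n ] 2  ∎
    ∑out≡∑Δ⁺ : ∑out ≡ ∑Δ⁺
    ∑out≡∑Δ⁺ = +-cancelˡ-≡ ∣ S ∣ _ _
      (trans (sym (∑∣∩closedInN∣≡∣S∣+∑outdeg S)) (trans ∑dom≡∑2 ∑2≡∣S∣+∑Δ⁺))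
    χ-true-* : ∀ {b x y} → b ≡ true → χ b * x ≡ χ b * y → x ≡ y
    χ-true-* refl eq = *-cancelˡ-≡ _ _ 1 eq
    exact : IsExactDoubleDominating S
    exact v = sym (∑-mono-≤-tight S-dd (sym ∑dom≡∑2) v)
    maximal : HasMaximumOutdegreeOn S
    maximal u u∈S = χ-true-* u∈S (∑-mono-≤-tight (χ*outdeg≤χ*Δ⁺ S) ∑out≡∑Δ⁺ u)

  exact∧maximal⇒bound-attained : ∀ S → IsExactDoubleDominating S → HasMaximumOutdegreeOn S →
    ∣ S ∣ * (Δ⁺ D + 1) ≡ 2 * n
  exact∧maximal⇒bound-attained S exact maximal = begin
    ∣ S ∣ * (Δ⁺ D + 1)                                ≡⟨ ∣S∣*[Δ⁺+1]≡∣S∣+∑Δ⁺ S ⟩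
    ∣ S ∣ + ∑[ u < n ] (χ (lookup S u) * Δ⁺ D)        ≡⟨ cong (∣ S ∣ +_) (sum-cong-≗ Δ⁺≡outdeg) ⟩
    ∣ S ∣ + ∑[ u < n ] (χ (lookup S u) * outdeg D u)  ≡⟨ ∑∣∩closedInN∣≡∣S∣+∑outdeg S ⟨
    ∑[ v < n ] ∣ S ∩ closedInN D v ∣                  ≡⟨ sum-cong-≗ exact ⟩
    ∑[ v < n ] 2                                      ≡⟨ 2n≡∑2 ⟨
    2 * n                                             ∎
    where
    open ≡-Reasoning
    Δ⁺≡outdeg : ∀ u → χ (lookup S u) * Δ⁺ D ≡ χ (lookup S u) * outdeg D u
    Δ⁺≡outdeg u with lookup S u in u∈S
    ... | true  = cong (1 *_) (sym (maximal u u∈S))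
    ... | false = refl

  exact⇒χ+indegFrom≡2 : ∀ S → IsExactDoubleDominating S → ∀ v → χ (lookup S v) + indegFrom S v ≡ 2
  exact⇒χ+indegFrom≡2 S exact v = trans (sym (∣∩closedInN∣≡χ+indegFrom S v)) (exact v)

  exact⇒double-dominating : ∀ S → IsExactDoubleDominating S → IsDoubleDominating D S
  exact⇒double-dominating S exact v = ≤-reflexive (sym (exact v))

  exact∧maximal⇒InΘ : ∀ S → IsExactDoubleDominating S → HasMaximumOutdegreeOn S → InΘ D
  exact∧maximal⇒InΘ S exact maximal = record
    { isV              = lookup S
    ; r                = Δ⁺ D
    ; contrafunctional = λ v v∈S →
        suc-injective (subst (λ b → χ b + indegFrom S v ≡ 2) v∈S (dominations v))
    ; r≥Δ⁺D'           = λ v _ → ≤-trans (∣tabulate-∧∣≤∣tabulate∣ (lookup S) (arc D v)) (outdeg≤Δ⁺ v)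
    ; sizeU            = sizeU
    ; twoArcs          = λ u u∉S → subst (λ b → χ b + indegFrom S u ≡ 2) u∉S (dominations u)
    ; outdegV          = maximal
    ; maxOut           = refl
    }
    where
    dominations : ∀ v → χ (lookup S v) + indegFrom S v ≡ 2
    dominations = exact⇒χ+indegFrom≡2 S exact
    sizeU : 2 * ∣ tabulate (λ u → not (lookup S u)) ∣ ≡ (Δ⁺ D ∸ 1) * ∣ tabulate (lookup S) ∣
    sizeU = begin
      2 * ∣ tabulate (λ u → not (lookup S u)) ∣
        ≡⟨ cong (2 *_) (∣tabulate-not∘lookup∣ S) ⟩
      2 * (n ∸ ∣ S ∣)
        ≡⟨ 2*[n∸g]≡[Δ∸1]*g n ∣ S ∣ (Δ⁺ D) (exact∧maximal⇒bound-attained S exact maximal) ⟩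
      (Δ⁺ D ∸ 1) * ∣ S ∣
        ≡⟨ cong (λ T → (Δ⁺ D ∸ 1) * ∣ T ∣) (tabulate∘lookup S) ⟨
      (Δ⁺ D ∸ 1) * ∣ tabulate (lookup S) ∣
        ∎
      where open ≡-Reasoning

  InΘ⇒exact∧maximal : (θ : InΘ D) → let S = tabulate (InΘ.isV θ) in
    IsExactDoubleDominating S × HasMaximumOutdegreeOn S
  InΘ⇒exact∧maximal θ = exact , maximal
    where
    open InΘ θ
    S : Subset n
    S = tabulate isV
    indegFrom≡ : ∀ v → indegFrom S v ≡ ∣ tabulate (λ u → isV u ∧ arc D u v) ∣
    indegFrom≡ v = cong ∣_∣ (tabulate-cong (λ u → cong (_∧ arc D u v) (lookup∘tabulate isV u)))
    dominated-twice : ∀ v → χ (isV v) + ∣ tabulate (λ u → isV u ∧ arc D u v) ∣ ≡ 2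
    dominated-twice v with isV v in v∈V
    ... | true  = cong suc (contrafunctional v v∈V)
    ... | false = twoArcs v v∈V
    exact : IsExactDoubleDominating S
    exact v = begin
      ∣ S ∩ closedInN D v ∣
        ≡⟨ ∣∩closedInN∣≡χ+indegFrom S v ⟩
      χ (lookup S v) + indegFrom S v
        ≡⟨ cong₂ _+_ (cong χ (lookup∘tabulate isV v)) (indegFrom≡ v) ⟩
      χ (isV v) + ∣ tabulate (λ u → isV u ∧ arc D u v) ∣
        ≡⟨ dominated-twice v ⟩
      2
        ∎
      where open ≡-Reasoning
    maximal : HasMaximumOutdegreeOn S
    maximal u u∈S = trans (outdegV u (trans (sym (lookup∘tabulate isV u)) u∈S)) (sym maxOut)

-- The hypothesis δ⁻ ≥ 1 only guarantees that V(D) is double dominating, i.e. that γ×2(D)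
-- exists; here that is already part of the assumption IsDoubleDominationNumber D g.
theorem3 : (n : ℕ) (D : Digraph n) → (∀ v → 1 ≤ indeg D v) →
    (g : ℕ) → IsDoubleDominationNumber D g →
    (2 * n ≤ g * (Δ⁺ D + 1)) × ((g * (Δ⁺ D + 1) ≡ 2 * n) ⇔ InΘ D)
theorem3 n D _ g ((S , S-dd , ∣S∣≡g) , g-minimum) = lower-bound , mk⇔ attained⇒InΘ InΘ⇒attained
  where
  lower-bound : 2 * n ≤ g * (Δ⁺ D + 1)
  lower-bound = subst (λ k → 2 * n ≤ k * (Δ⁺ D + 1)) ∣S∣≡g (double-domination-bound D S S-dd)

  attained⇒InΘ : g * (Δ⁺ D + 1) ≡ 2 * n → InΘ D
  attained⇒InΘ attained with double-domination-bound-attained D S S-dd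
                               (subst (λ k → k * (Δ⁺ D + 1) ≡ 2 * n) (sym ∣S∣≡g) attained)
  ... | exact , maximal = exact∧maximal⇒InΘ D S exact maximal

  InΘ⇒attained : InΘ D → g * (Δ⁺ D + 1) ≡ 2 * n
  InΘ⇒attained θ with InΘ⇒exact∧maximal D θ
  ... | exact , maximal = ≤-antisym
    (≤-trans (*-monoˡ-≤ (Δ⁺ D + 1) (g-minimum V (exact⇒double-dominating D V exact)))
             (≤-reflexive (exact∧maximal⇒bound-attained D V exact maximal)))
    lower-bound
    where
    V : Subset n
    V = tabulate (InΘ.isV θ)
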